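{- Let $s\geq 3$ and $v=3s$. Then there exist a cubic bipartite graph $\Gamma$ of order $2s$, a symmetric configuration $\mathcal{X}$ on $v$ points with strong chromatic number $3$, and a strong $3$-colouring of $\mathcal{X}$ with colour classes $V_1,V_2,V_3$, such that for each $k\in\{1,2,3\}$ the subgraph of the associated graph of $\mathcal{X}$ induced by the points not in $V_k$ is isomorphic to $\Gamma$.
   Context: A symmetric configuration $v_3$ is a finite incidence structure consisting of a set $V$ of $v$ points and a collection of $v$ blocks, each block a $3$-element subset of $V$, such that each point lies in exactly $3$ blocks and any two distinct points lie together in at most one block. Its associated graph has vertex set $V$, two points being adjacent iff they lie in a common block. A strong colouring is an assignment of colours to points such that the three points of every block receive three distinct colours; the strong chromatic number is the minimum number of colours in a strong colouring. -}

module Defs where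

open import Data.Nat using (ℕ; _<_)
open import Data.Fin using (Fin)
open import Data.Bool using (Bool; true)
open import Data.Product using (Σ; _×_; ∃; ∃-syntax; proj₁)
open import Relation.Binary.PropositionalEquality using (_≡_; _≢_)
open import Relation.Nullary using (¬_)
open import Function.Bundles using (_↔_; _⇔_; Inverse)
open import Function.Definitions using (Injective)

record Graph (n : ℕ) : Set where
  field
    adj     : Fin n → Fin n → Bool
    irrefl  : ∀ x → ¬ (adj x x ≡ true)
    sym     : ∀ x y → adj x y ≡ true → adj y x ≡ true

open Graph public

Cubic : ∀ {n} → Graph n → Set
Cubic {n} G = ∀ x → Σ (Fin n) (λ y → adj G x y ≡ true) ↔ Fin 3

Bipartite : ∀ {n} → Graph n → Set
Bipartite {n} G =
  Σ (Fin n → Bool) λ side → ∀ (x y : Fin n) → adj G x y ≡ true → side x ≢ side y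

-- Symmetric configurations v_3 on the point set Fin v.
-- There are v blocks (indexed by Fin v); block b is given by the map
-- Fin 3 → Fin v listing its three points.

module _ {v : ℕ} (block : Fin v → Fin 3 → Fin v) where

  OnBlock : Fin v → Fin v → Set
  OnBlock p b = ∃[ i ] block b i ≡ p

record Configuration (v : ℕ) : Set where
  field
    block       : Fin v → Fin 3 → Fin v
    block-3set  : ∀ b → Injective _≡_ _≡_ (block b)
    point-deg   : ∀ p → Σ (Fin v) (λ b → OnBlock block p b) ↔ Fin 3
    linear      : ∀ p q → p ≢ q → ∀ b b' →
                  OnBlock block p b → OnBlock block q b →
                  OnBlock block p b' → OnBlock block q b' → b ≡ b'

open Configuration public

AssocAdj : ∀ {v} → Configuration v → Fin v → Fin v → Set
AssocAdj X p q = p ≢ q × ∃[ b ] (OnBlock (block X) p b × OnBlock (block X) q b)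

StrongColouring : ∀ {v} → Configuration v → (k : ℕ) → (Fin v → Fin k) → Set
StrongColouring X k c = ∀ b → Injective _≡_ _≡_ (λ i → c (block X b i))

StrongChromaticNumber : ∀ {v} → Configuration v → ℕ → Set
StrongChromaticNumber {v} X k =
  (∃[ c ] StrongColouring X k c) ×
  (∀ m → m < k → ¬ (∃[ c ] StrongColouring X m c))

InducedOffClassIso : ∀ {v n} → Configuration v → (Fin v → Fin 3) → Fin 3 →
                     Graph n → Set
InducedOffClassIso {v} {n} X c k Γ =
  Σ (Fin n ↔ Σ (Fin v) (λ p → c p ≢ k)) λ f →
    ∀ x y → (adj Γ x y ≡ true) ⇔
            AssocAdj X (proj₁ (Inverse.to f x)) (proj₁ (Inverse.to f y))

module Submission where

-- Take points (t , x) with a colour t ∈ Fin 3 and a position x ∈ ℤ/s, and let σ be x ↦ x + 1.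
-- The block (j , i) consists of the points (t , σ^(t·j mod 3) i), so the colour t is a strong
-- 3-colouring and each point lies on one block of each direction j. If two points of colours
-- t ≠ u shared blocks of directions j ≠ j′, then σ^a y = σ^b y for exponents a, b differing by
-- 1 or 2 (a finite check on the table t·j mod 3), impossible for s ≥ 3. After deleting the colour
-- class k and shifting one of the two remaining classes by a constant, along the three directions
-- the two remaining colours of a block are 0, 1 and 2 steps apart; hence the induced graph is, for
-- every k, the bipartite graph joining (0 , x) to (1 , x), (1 , σ x) and (1 , σ² x).

open import Defs
open import Data.Nat using (ℕ; _≥_; _*_)
open import Data.Fin using (Fin)
open import Data.Product using (Σ; _×_; ∃-syntax)

open import Axiom.UniquenessOfIdentityProofs.WithK using (uip)
open import Data.Bool using (Bool; true; false)
open import Data.Empty using (⊥; ⊥-elim)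
open import Data.Fin using (zero; suc; toℕ; fromℕ; fromℕ<; inject₁; punchIn; punchOut)
open import Data.Fin.Patterns using (0F; 1F; 2F)
open import Data.Fin.Properties
  using (all?; any?; pigeonhole; *↔×; 0≢1+n;
         punchIn-injective; punchInᵢ≢i; punchIn-punchOut; punchOut-punchIn;
         toℕ-injective; toℕ-fromℕ; toℕ-fromℕ<; toℕ-inject₁; toℕ<n; toℕ≤pred[n])
import Data.Fin.Properties as Fin
open import Data.Nat using (zero; suc; _+_; _<_; s≤s)
import Data.Nat.Properties as ℕ
open import Data.Product using (∃; _,_; proj₁)
open import Data.Product.Function.Dependent.Propositional using (Σ-↔)
open import Data.Product.Properties using (Σ-≡,≡→≡)
open import Data.Sum using (_⊎_; inj₁; inj₂)
open import Function using (_∘_)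
open import Function.Bundles using (_↔_; _⇔_; Inverse; Equivalence; Injection; mk↔ₛ′; mk⇔)
open import Function.Definitions using (Injective)
open import Function.Properties.Inverse using (↔-refl; ↔-sym; ↔-trans; ↔⇒⇔; ↔⇒↣)
open import Function.Properties.Equivalence using () renaming (sym to ⇔-sym; trans to ⇔-trans)
open import Relation.Binary.Definitions using (DecidableEquality)
open import Relation.Binary.PropositionalEquality
  using (_≡_; _≢_; refl; trans; cong; cong₂; subst; subst₂; module ≡-Reasoning)
import Relation.Binary.PropositionalEquality as ≡
open import Relation.Nullary using (¬_; Dec; yes; no; does)
open import Relation.Nullary.Decidable using (dec-true; from-yes; ¬?; _→-dec_; _⊎-dec_)
open import Relation.Nullary.Irrelevant using (Irrelevant)

fibre-irrelevant : ∀ {A B : Set} {f : A → B} → Injective _≡_ _≡_ f →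
                   ∀ {y} → Irrelevant (∃ λ x → f x ≡ y)
fibre-irrelevant f-injective (x , refl) (x′ , eq) with f-injective eq
... | refl = cong (x ,_) (uip refl eq)

Σ-irrelevant-↔ : ∀ {B C : Set} {P : B → Set} → (∀ {b} → Irrelevant (P b)) →
                 (index : Σ B P → C) (enum : C → Σ B P) →
                 (∀ c → index (enum c) ≡ c) →
                 (∀ x → proj₁ (enum (index x)) ≡ proj₁ x) →
                 Σ B P ↔ C
Σ-irrelevant-↔ P-irrelevant index enum index-enum enum-index =
  mk↔ₛ′ index enum index-enum (λ x → Σ-≡,≡→≡ (enum-index x , P-irrelevant _ _))

Σ-¬-reindex : ∀ {I J : Set} (e : I ↔ J) {C : J → Set} →
              Σ J (¬_ ∘ C) ↔ Σ I (¬_ ∘ C ∘ Inverse.to e)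
Σ-¬-reindex e {C} = mk↔ₛ′
  (λ (j , ¬c) → from j , ¬c ∘ subst C (strictlyInverseˡ j)) (λ (i , ¬c) → to i , ¬c)
  (λ (i , _) → Σ-≡,≡→≡ (strictlyInverseʳ i , refl))
  (λ (j , _) → Σ-≡,≡→≡ (strictlyInverseˡ j , refl))
  where open Inverse e

does-≡-true-↔ : ∀ {A : Set} (a? : Dec A) → Irrelevant A → (does a? ≡ true) ↔ A
does-≡-true-↔ (yes a) A-irrelevant =
  mk↔ₛ′ (λ _ → a) (λ _ → refl) (A-irrelevant a) (λ { refl → refl })
does-≡-true-↔ (no ¬a) _ = mk↔ₛ′ (λ ()) (⊥-elim ∘ ¬a) (⊥-elim ∘ ¬a) (λ ())

recolour-↔ : ∀ {n} {A : Set} (k : Fin (suc n)) (τ : Fin n → A ↔ A) →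
             (Fin n × A) ↔ Σ (Fin (suc n) × A) (λ p → proj₁ p ≢ k)
recolour-↔ {n} {A} k τ = mk↔ₛ′ embed restrict embed-restrict restrict-embed
  where
  embed : Fin n × A → Σ (Fin (suc n) × A) (λ p → proj₁ p ≢ k)
  embed (a , x) = (punchIn k a , Inverse.to (τ a) x) , punchInᵢ≢i k a

  restrict : Σ (Fin (suc n) × A) (λ p → proj₁ p ≢ k) → Fin n × A
  restrict ((t , x) , t≢k) = let a = punchOut (t≢k ∘ ≡.sym) in a , Inverse.from (τ a) x

  embed-restrict : ∀ y → embed (restrict y) ≡ y
  embed-restrict ((t , x) , t≢k) = Σ-≡,≡→≡
    (cong₂ _,_ (punchIn-punchOut (t≢k ∘ ≡.sym)) (Inverse.strictlyInverseˡ (τ _) x) , refl)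

  restrict-embed : ∀ y → restrict (embed y) ≡ y
  restrict-embed (a , x) = reindexed (punchOut-punchIn k)
    where
    reindexed : ∀ {a′} → a′ ≡ a → (a′ , Inverse.from (τ a′) (Inverse.to (τ a) x)) ≡ (a , x)
    reindexed refl = cong (a ,_) (Inverse.strictlyInverseʳ (τ a) x)

Incident : ∀ {P : Set} → (P → Fin 3 → P) → P → P → Set
Incident line p b = ∃[ i ] line b i ≡ p

record ConfigurationOn (P : Set) : Set where
  field
    line             : P → Fin 3 → P
    line-injective   : ∀ b → Injective _≡_ _≡_ (line b)
    point-degree     : ∀ p → Σ P (Incident line p) ↔ Fin 3
    at-most-one-line : ∀ p q → p ≢ q → ∀ b b′ →
                       Incident line p b → Incident line q b →
                       Incident line p b′ → Incident line q b′ → b ≡ b′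

AssocAdjOn : ∀ {P} → ConfigurationOn P → P → P → Set
AssocAdjOn Y p q = p ≢ q × ∃[ b ] (Incident line p b × Incident line q b)
  where open ConfigurationOn Y

assocAdjOn-sym : ∀ {P} {Y : ConfigurationOn P} {p q} → AssocAdjOn Y p q → AssocAdjOn Y q p
assocAdjOn-sym (p≢q , b , on-p , on-q) = p≢q ∘ ≡.sym , b , on-q , on-p

module Transport {v : ℕ} {P : Set} (e : Fin v ↔ P) (Y : ConfigurationOn P) where
  open Inverse e
  open ConfigurationOn Y

  to-injective : Injective _≡_ _≡_ to
  to-injective = Injection.injective (↔⇒↣ e)

  from-injective : Injective _≡_ _≡_ from
  from-injective = Injection.injective (↔⇒↣ (↔-sym e))

  blockᶠ : Fin v → Fin 3 → Fin v
  blockᶠ b i = from (line (to b) i)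

  from-≡-↔ : ∀ {x p} → (from x ≡ p) ↔ (x ≡ to p)
  from-≡-↔ = mk↔ₛ′ (λ eq → trans (≡.sym (strictlyInverseˡ _)) (cong to eq))
                   (λ eq → trans (cong from eq) (strictlyInverseʳ _))
                   (λ _ → uip _ _) (λ _ → uip _ _)

  onBlock-↔ : ∀ {p b} → OnBlock blockᶠ p b ↔ Incident line (to p) (to b)
  onBlock-↔ = Σ-↔ ↔-refl from-≡-↔

  configuration : Configuration v
  configuration = record
    { block      = blockᶠ
    ; block-3set = λ b → line-injective (to b) ∘ from-injective
    ; point-deg  = λ p → ↔-trans (Σ-↔ e onBlock-↔) (point-degree (to p))
    ; linear     = λ p q p≢q b b′ on₁ on₂ on₃ on₄ → to-injective
        (at-most-one-line (to p) (to q) (p≢q ∘ to-injective) (to b) (to b′)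
          (incident on₁) (incident on₂) (incident on₃) (incident on₄))
    }
    where
    incident : ∀ {p b} → OnBlock blockᶠ p b → Incident line (to p) (to b)
    incident = Inverse.to onBlock-↔

  strongColouring : ∀ {m} (colour : P → Fin m) → (∀ b → Injective _≡_ _≡_ (colour ∘ line b)) →
                    StrongColouring configuration m (colour ∘ to)
  strongColouring colour colour-injective b eq = colour-injective (to b)
    (trans (cong colour (≡.sym (strictlyInverseˡ _))) (trans eq (cong colour (strictlyInverseˡ _))))

  assocAdj-from⇔ : ∀ {p q} → AssocAdj configuration (from p) (from q) ⇔ AssocAdjOn Y p q
  assocAdj-from⇔ = mk⇔
    (λ (p≢q , b , on₁ , on₂) → p≢q ∘ cong from , to b , incident on₁ , incident on₂)
    (λ (p≢q , c , on₁ , on₂) → p≢q ∘ from-injective , from c , onBlock on₁ , onBlock on₂)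
    where
    incident : ∀ {p b} → OnBlock blockᶠ (from p) b → Incident line p (to b)
    incident {p} {b} on =
      subst (λ p′ → Incident line p′ (to b)) (strictlyInverseˡ p) (Inverse.to onBlock-↔ on)
    onBlock : ∀ {p c} → Incident line p c → OnBlock blockᶠ (from p) (from c)
    onBlock {p} {c} on = Inverse.from onBlock-↔
      (subst₂ (Incident line) (≡.sym (strictlyInverseˡ p)) (≡.sym (strictlyInverseˡ c)) on)

module GraphTransport {n : ℕ} {Q : Set} (e : Fin n ↔ Q) {E : Q → Q → Set}
                      (E? : ∀ q r → Dec (E q r)) (E-irrelevant : ∀ {q r} → Irrelevant (E q r))
                      (E-irreflexive : ∀ q → ¬ E q q) (E-sym : ∀ {q r} → E q r → E r q) where
  open Inverse e

  adjacency : Fin n → Fin n → Bool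
  adjacency x y = does (E? (to x) (to y))

  adjacency-↔ : ∀ {x y} → (adjacency x y ≡ true) ↔ E (to x) (to y)
  adjacency-↔ = does-≡-true-↔ (E? _ _) E-irrelevant

  graph : Graph n
  graph = record
    { adj    = adjacency
    ; irrefl = λ x → E-irreflexive (to x) ∘ Inverse.to adjacency-↔
    ; sym    = λ x y → dec-true (E? _ _) ∘ E-sym ∘ Inverse.to adjacency-↔
    }

  cubic : (∀ q → Σ Q (E q) ↔ Fin 3) → Cubic graph
  cubic degree x = ↔-trans (Σ-↔ e adjacency-↔) (degree (to x))

  bipartite : (side : Q → Bool) → (∀ {q r} → E q r → side q ≢ side r) → Bipartite graph
  bipartite side E-bichromatic = side ∘ to , λ x y → E-bichromatic ∘ Inverse.to adjacency-↔

  inducedOffClassIso : ∀ {v P} (eP : Fin v ↔ P) (Y : ConfigurationOn P)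
    (colour : P → Fin 3) (k : Fin 3) (φ : Q ↔ Σ P (λ p → colour p ≢ k)) →
    (∀ q r → E q r ⇔ AssocAdjOn Y (proj₁ (Inverse.to φ q)) (proj₁ (Inverse.to φ r))) →
    InducedOffClassIso (Transport.configuration eP Y) (colour ∘ Inverse.to eP) k graph
  inducedOffClassIso eP Y colour k φ E⇔assocAdj =
    ↔-trans e (↔-trans φ (Σ-¬-reindex eP)) , λ x y →
      ⇔-trans (↔⇒⇔ adjacency-↔)
        (⇔-trans (E⇔assocAdj (to x) (to y)) (⇔-sym (Transport.assocAdj-from⇔ eP Y)))

strong-colouring-needs-3 : ∀ {v} (X : Configuration v) → Fin v → ∀ m → m < 3 →
                           ¬ (∃[ c ] StrongColouring X m c)
strong-colouring-needs-3 X b m m<3 (c , strong) with pigeonhole m<3 (λ i → c (block X b i))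
... | i , j , i<j , same-colour = Fin.<-irrefl (strong b same-colour) i<j

module Powers {A : Set} (σ : A ↔ A) where
  open Inverse σ

  σ^ : ℕ → A → A
  σ^ zero    x = x
  σ^ (suc n) x = to (σ^ n x)

  σ⁻^ : ℕ → A → A
  σ⁻^ zero    x = x
  σ⁻^ (suc n) x = σ⁻^ n (from x)

  σ^-σ⁻^ : ∀ n x → σ^ n (σ⁻^ n x) ≡ x
  σ^-σ⁻^ zero    x = refl
  σ^-σ⁻^ (suc n) x = trans (cong to (σ^-σ⁻^ n (from x))) (strictlyInverseˡ x)

  σ⁻^-σ^ : ∀ n x → σ⁻^ n (σ^ n x) ≡ x
  σ⁻^-σ^ zero    x = refl
  σ⁻^-σ^ (suc n) x = trans (cong (σ⁻^ n) (strictlyInverseʳ (σ^ n x))) (σ⁻^-σ^ n x)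

  power : ℕ → A ↔ A
  power n = mk↔ₛ′ (σ^ n) (σ⁻^ n) (σ^-σ⁻^ n) (σ⁻^-σ^ n)

  σ^-injective : ∀ n → Injective _≡_ _≡_ (σ^ n)
  σ^-injective n = Injection.injective (↔⇒↣ (power n))

  σ^-transpose : ∀ n {x y} → σ^ n x ≡ y → x ≡ σ⁻^ n y
  σ^-transpose n {x} eq = trans (≡.sym (σ⁻^-σ^ n x)) (cong (σ⁻^ n) eq)

  σ^-+ : ∀ m n x → σ^ (m + n) x ≡ σ^ m (σ^ n x)
  σ^-+ zero    n x = refl
  σ^-+ (suc m) n x = cong to (σ^-+ m n x)

  σ^-comm : ∀ m n x → σ^ m (σ^ n x) ≡ σ^ n (σ^ m x)
  σ^-comm m n x = begin
    σ^ m (σ^ n x) ≡⟨ σ^-+ m n x ⟨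
    σ^ (m + n) x  ≡⟨ cong (λ k → σ^ k x) (ℕ.+-comm m n) ⟩
    σ^ (n + m) x  ≡⟨ σ^-+ n m x ⟩
    σ^ n (σ^ m x) ∎
    where open ≡-Reasoning

  σ^-crossed : ∀ a b c d {x y} → σ^ a x ≡ σ^ b y → σ^ c x ≡ σ^ d y → σ^ (a + d) x ≡ σ^ (b + c) x
  σ^-crossed a b c d {x} {y} eq₁ eq₂ = begin
    σ^ (a + d) x   ≡⟨ σ^-+ a d x ⟩
    σ^ a (σ^ d x)  ≡⟨ σ^-comm a d x ⟩
    σ^ d (σ^ a x)  ≡⟨ cong (σ^ d) eq₁ ⟩
    σ^ d (σ^ b y)  ≡⟨ σ^-comm d b y ⟩
    σ^ b (σ^ d y)  ≡⟨ cong (σ^ b) eq₂ ⟨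
    σ^ b (σ^ c x)  ≡⟨ σ^-+ b c x ⟨
    σ^ (b + c) x   ∎
    where open ≡-Reasoning

Gap : ℕ → ℕ → Set
Gap m n = m ≡ suc n ⊎ m ≡ suc (suc n)

Near : ℕ → ℕ → Set
Near m n = Gap m n ⊎ Gap n m

near? : ∀ m n → Dec (Near m n)
near? m n = gap? m n ⊎-dec gap? n m
  where
  gap? : ∀ m n → Dec (Gap m n)
  gap? m n = (m ℕ.≟ suc n) ⊎-dec (m ℕ.≟ suc (suc n))

exponents-near : ∀ (e e′ : Fin 3) → e ≢ e′ → Near (toℕ e) (toℕ e′)
exponents-near = from-yes decision
  where
  decision : Dec (∀ (e e′ : Fin 3) → e ≢ e′ → Near (toℕ e) (toℕ e′))
  decision = all? λ e → all? λ e′ → ¬? (e Fin.≟ e′) →-dec near? _ _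

-- offset t j = t · j mod 3
offset : Fin 3 → Fin 3 → ℕ
offset 0F j  = 0
offset 1F j  = toℕ j
offset 2F 0F = 0
offset 2F 1F = 2
offset 2F 2F = 1

offsets-near : ∀ t u j j′ → t ≢ u → j ≢ j′ →
               Near (offset t j + offset u j′) (offset t j′ + offset u j)
offsets-near = from-yes decision
  where
  decision : Dec (∀ t u j j′ → t ≢ u → j ≢ j′ →
                  Near (offset t j + offset u j′) (offset t j′ + offset u j))
  decision = all? λ t → all? λ u → all? λ j → all? λ j′ →
    ¬? (t Fin.≟ u) →-dec ¬? (j Fin.≟ j′) →-dec near? _ _

-- Once colour k is removed, the remaining colours are punchIn k 0F and punchIn k 1F; shifting
-- the second one back by lag k, it is 0, 1 or 2 steps ahead of the first, each for one direction.
lag : Fin 3 → ℕ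
lag 0F = 1
lag _  = 0

Aligned : Fin 3 → Fin 3 → Fin 3 → Set
Aligned k j e = lag k + offset (punchIn k 1F) j ≡ toℕ e + offset (punchIn k 0F) j

aligned-exponent : ∀ k j → ∃ (Aligned k j)
aligned-exponent = from-yes decision
  where
  decision : Dec (∀ k j → ∃ (Aligned k j))
  decision = all? λ k → all? λ j → any? λ e → _ ℕ.≟ _

aligned-direction : ∀ k e → ∃ λ j → Aligned k j e
aligned-direction = from-yes decision
  where
  decision : Dec (∀ k e → ∃ λ j → Aligned k j e)
  decision = all? λ k → all? λ e → any? λ j → _ ℕ.≟ _

module Construction {A : Set} (_≟_ : DecidableEquality A) (σ : A ↔ A)
                    (no-fixed-point : ∀ x → Inverse.to σ x ≢ x)
                    (no-2-cycle : ∀ x → Inverse.to σ (Inverse.to σ x) ≢ x) where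
  open Powers σ

  gap-distinct : ∀ {m n} x → Gap m n → σ^ m x ≢ σ^ n x
  gap-distinct x (inj₁ refl) = no-fixed-point _
  gap-distinct x (inj₂ refl) = no-2-cycle _

  near-distinct : ∀ {m n} x → Near m n → σ^ m x ≢ σ^ n x
  near-distinct x (inj₁ gap) = gap-distinct x gap
  near-distinct x (inj₂ gap) = gap-distinct x gap ∘ ≡.sym

  exponent-injective : ∀ x → Injective _≡_ _≡_ (λ (e : Fin 3) → σ^ (toℕ e) x)
  exponent-injective x {e} {e′} eq with e Fin.≟ e′
  ... | yes e≡e′ = e≡e′
  ... | no e≢e′  = ⊥-elim (near-distinct x (exponents-near e e′ e≢e′) eq)

  Point : Set
  Point = Fin 3 × A

  -- The block (j , i) is the line of direction j through the point (0 , i).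
  line : Point → Fin 3 → Point
  line (j , i) t = t , σ^ (offset t j) i

  incident-offset : ∀ {t x j i} → Incident line (t , x) (j , i) → σ^ (offset t j) i ≡ x
  incident-offset (_ , refl) = refl

  offset-incident : ∀ {t x j i} → σ^ (offset t j) i ≡ x → Incident line (t , x) (j , i)
  offset-incident {t} eq = t , cong (t ,_) eq

  line-injective : ∀ b → Injective _≡_ _≡_ (line b)
  line-injective b = cong proj₁

  lines-through : ∀ p → Σ Point (Incident line p) ↔ Fin 3
  lines-through (t , x) = Σ-irrelevant-↔ (fibre-irrelevant (line-injective _))
    (proj₁ ∘ proj₁) through (λ _ → refl) through-direction
    where
    through : Fin 3 → Σ Point (Incident line (t , x))
    through j = (j , σ⁻^ (offset t j) x) , offset-incident (σ^-σ⁻^ (offset t j) x)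
    through-direction : ∀ y → proj₁ (through (proj₁ (proj₁ y))) ≡ proj₁ y
    through-direction ((j , i) , on) = cong (j ,_) (≡.sym (σ^-transpose (offset t j) (incident-offset on)))

  concurrent : ∀ t u {j j′ i i′} → t ≢ u →
               σ^ (offset t j) i ≡ σ^ (offset t j′) i′ → σ^ (offset u j) i ≡ σ^ (offset u j′) i′ →
               (j , i) ≡ (j′ , i′)
  concurrent t u {j} {j′} t≢u eq-t eq-u with j Fin.≟ j′
  ... | yes refl = cong (j ,_) (σ^-injective (offset t j) eq-t)
  ... | no j≢j′  = ⊥-elim (near-distinct _ (offsets-near t u j j′ t≢u j≢j′)
                     (σ^-crossed (offset t j) (offset t j′) (offset u j) (offset u j′) eq-t eq-u))

  at-most-one-line : ∀ p q → p ≢ q → ∀ b b′ →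
                     Incident line p b → Incident line q b →
                     Incident line p b′ → Incident line q b′ → b ≡ b′
  at-most-one-line (t , x) (u , y) p≢q (j , i) (j′ , i′) on₁ on₂ on₃ on₄ =
    concurrent t u t≢u (trans (incident-offset on₁) (≡.sym (incident-offset on₃)))
                       (trans (incident-offset on₂) (≡.sym (incident-offset on₄)))
    where
    t≢u : t ≢ u
    t≢u refl = p≢q (cong (t ,_) (trans (≡.sym (incident-offset on₁)) (incident-offset on₂)))

  configuration : ConfigurationOn Point
  configuration = record
    { line             = line
    ; line-injective   = line-injective
    ; point-degree     = lines-through
    ; at-most-one-line = at-most-one-line
    }

  monochromatic-nonadjacent : ∀ {t x y} → ¬ AssocAdjOn configuration (t , x) (t , y)
  monochromatic-nonadjacent {t} (p≢q , _ , on₁ , on₂) =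
    p≢q (cong (t ,_) (trans (≡.sym (incident-offset on₁)) (incident-offset on₂)))

  Vertex : Set
  Vertex = Fin 2 × A

  Edge : Vertex → Vertex → Set
  Edge (0F , l) (1F , r) = Σ (Fin 3) λ e → σ^ (toℕ e) l ≡ r
  Edge (1F , r) (0F , l) = Σ (Fin 3) λ e → σ^ (toℕ e) l ≡ r
  Edge (0F , _) (0F , _) = ⊥
  Edge (1F , _) (1F , _) = ⊥

  edge? : ∀ q r → Dec (Edge q r)
  edge? (0F , l) (1F , r) = any? λ e → σ^ (toℕ e) l ≟ r
  edge? (1F , r) (0F , l) = any? λ e → σ^ (toℕ e) l ≟ r
  edge? (0F , _) (0F , _) = no λ ()
  edge? (1F , _) (1F , _) = no λ ()

  edge-irrelevant : ∀ {q r} → Irrelevant (Edge q r)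
  edge-irrelevant {0F , l} {1F , _} = fibre-irrelevant (exponent-injective l)
  edge-irrelevant {1F , _} {0F , l} = fibre-irrelevant (exponent-injective l)
  edge-irrelevant {0F , _} {0F , _} ()
  edge-irrelevant {1F , _} {1F , _} ()

  edge-irreflexive : ∀ q → ¬ Edge q q
  edge-irreflexive (0F , _) ()
  edge-irreflexive (1F , _) ()

  edge-sym : ∀ {q r} → Edge q r → Edge r q
  edge-sym {0F , _} {1F , _} edge = edge
  edge-sym {1F , _} {0F , _} edge = edge
  edge-sym {0F , _} {0F , _} ()
  edge-sym {1F , _} {1F , _} ()

  neighbours : ∀ q → Σ Vertex (Edge q) ↔ Fin 3
  neighbours (0F , l) =
    Σ-irrelevant-↔ (λ {r} → edge-irrelevant {0F , l} {r}) exponent enum (λ _ → refl) enum-exponent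
    where
    exponent : Σ Vertex (Edge (0F , l)) → Fin 3
    exponent ((1F , _) , e , _) = e
    exponent ((0F , _) , ())
    enum : Fin 3 → Σ Vertex (Edge (0F , l))
    enum e = (1F , σ^ (toℕ e) l) , e , refl
    enum-exponent : ∀ y → proj₁ (enum (exponent y)) ≡ proj₁ y
    enum-exponent ((1F , _) , _ , eq) = cong (1F ,_) eq
    enum-exponent ((0F , _) , ())
  neighbours (1F , r) =
    Σ-irrelevant-↔ (λ {l} → edge-irrelevant {1F , r} {l}) exponent enum (λ _ → refl) enum-exponent
    where
    exponent : Σ Vertex (Edge (1F , r)) → Fin 3
    exponent ((0F , _) , e , _) = e
    exponent ((1F , _) , ())
    enum : Fin 3 → Σ Vertex (Edge (1F , r))
    enum e = (0F , σ⁻^ (toℕ e) r) , e , σ^-σ⁻^ (toℕ e) r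
    enum-exponent : ∀ y → proj₁ (enum (exponent y)) ≡ proj₁ y
    enum-exponent ((0F , _) , e , eq) = cong (0F ,_) (≡.sym (σ^-transpose (toℕ e) eq))
    enum-exponent ((1F , _) , ())

  side : Vertex → Bool
  side (0F , _) = true
  side (1F , _) = false

  edge-bichromatic : ∀ {q r} → Edge q r → side q ≢ side r
  edge-bichromatic {0F , _} {1F , _} _ ()
  edge-bichromatic {1F , _} {0F , _} _ ()
  edge-bichromatic {0F , _} {0F , _} ()
  edge-bichromatic {1F , _} {1F , _} ()

  recolouring : ∀ k → Vertex ↔ Σ Point (λ p → proj₁ p ≢ k)
  recolouring k = recolour-↔ k λ { 0F → ↔-refl ; 1F → ↔-sym (power (lag k)) }

  aligned-shift : ∀ k j e → Aligned k j e → ∀ i →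
                  σ^ (lag k) (σ^ (offset (punchIn k 1F) j) i) ≡
                  σ^ (toℕ e) (σ^ (offset (punchIn k 0F) j) i)
  aligned-shift k j e aligned i = begin
    σ^ (lag k) (σ^ (offset (punchIn k 1F) j) i) ≡⟨ σ^-+ (lag k) _ i ⟨
    σ^ (lag k + offset (punchIn k 1F) j) i      ≡⟨ cong (λ n → σ^ n i) aligned ⟩
    σ^ (toℕ e + offset (punchIn k 0F) j) i      ≡⟨ σ^-+ (toℕ e) _ i ⟩
    σ^ (toℕ e) (σ^ (offset (punchIn k 0F) j) i) ∎
    where open ≡-Reasoning

  cross-edge⇔ : ∀ k {l r} → (Σ (Fin 3) λ e → σ^ (toℕ e) l ≡ r) ⇔
                AssocAdjOn configuration (punchIn k 0F , l) (punchIn k 1F , σ⁻^ (lag k) r)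
  cross-edge⇔ k {l} {r} = mk⇔ adjacent edge
    where
    t = punchIn k 0F
    u = punchIn k 1F
    open ≡-Reasoning

    adjacent : (Σ (Fin 3) λ e → σ^ (toℕ e) l ≡ r) → AssocAdjOn configuration (t , l) (u , σ⁻^ (lag k) r)
    adjacent (e , refl) with aligned-direction k e
    ... | j , aligned =
      0≢1+n ∘ punchIn-injective k 0F 1F ∘ cong proj₁ , (j , i) ,
      offset-incident (σ^-σ⁻^ (offset t j) l) , offset-incident (σ^-transpose (lag k) (begin
        σ^ (lag k) (σ^ (offset u j) i) ≡⟨ aligned-shift k j e aligned i ⟩
        σ^ (toℕ e) (σ^ (offset t j) i) ≡⟨ cong (σ^ (toℕ e)) (σ^-σ⁻^ (offset t j) l) ⟩
        σ^ (toℕ e) l                   ∎))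
      where i = σ⁻^ (offset t j) l

    edge : AssocAdjOn configuration (t , l) (u , σ⁻^ (lag k) r) → Σ (Fin 3) λ e → σ^ (toℕ e) l ≡ r
    edge (_ , (j , i) , on-t , on-u) with aligned-exponent k j
    ... | e , aligned = e , (begin
      σ^ (toℕ e) l                   ≡⟨ cong (σ^ (toℕ e)) (incident-offset on-t) ⟨
      σ^ (toℕ e) (σ^ (offset t j) i) ≡⟨ aligned-shift k j e aligned i ⟨
      σ^ (lag k) (σ^ (offset u j) i) ≡⟨ cong (σ^ (lag k)) (incident-offset on-u) ⟩
      σ^ (lag k) (σ⁻^ (lag k) r)     ≡⟨ σ^-σ⁻^ (lag k) r ⟩
      r                              ∎)

  edge⇔assocAdj : ∀ k q r → Edge q r ⇔ AssocAdjOn configuration (proj₁ (Inverse.to (recolouring k) q))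
                                                               (proj₁ (Inverse.to (recolouring k) r))
  edge⇔assocAdj k (0F , l) (1F , r) = cross-edge⇔ k
  edge⇔assocAdj k (1F , r) (0F , l) =
    mk⇔ (swap ∘ Equivalence.to (cross-edge⇔ k)) (Equivalence.from (cross-edge⇔ k) ∘ swap)
    where
    swap : ∀ {p q} → AssocAdjOn configuration p q → AssocAdjOn configuration q p
    swap = assocAdjOn-sym {Y = configuration}
  edge⇔assocAdj k (0F , _) (0F , _) = mk⇔ (λ ()) (⊥-elim ∘ monochromatic-nonadjacent)
  edge⇔assocAdj k (1F , _) (1F , _) = mk⇔ (λ ()) (⊥-elim ∘ monochromatic-nonadjacent)

module Rotation (m : ℕ) where
  private
    n : ℕ
    n = suc (suc m)

  rotate : Fin (suc n) → Fin (suc n)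
  rotate x with toℕ x ℕ.<? n
  ... | yes x<n = suc (fromℕ< x<n)
  ... | no _    = zero

  rotate⁻¹ : Fin (suc n) → Fin (suc n)
  rotate⁻¹ zero    = fromℕ n
  rotate⁻¹ (suc x) = inject₁ x

  toℕ-last : ∀ {x : Fin (suc n)} → ¬ toℕ x < n → toℕ x ≡ n
  toℕ-last x≮n = ℕ.≤-antisym (toℕ≤pred[n] _) (ℕ.≮⇒≥ x≮n)

  rotate⁻¹-rotate : ∀ x → rotate⁻¹ (rotate x) ≡ x
  rotate⁻¹-rotate x with toℕ x ℕ.<? n
  ... | yes x<n = toℕ-injective (trans (toℕ-inject₁ _) (toℕ-fromℕ< x<n))
  ... | no x≮n  = toℕ-injective (trans (toℕ-fromℕ n) (≡.sym (toℕ-last x≮n)))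

  rotate-rotate⁻¹ : ∀ x → rotate (rotate⁻¹ x) ≡ x
  rotate-rotate⁻¹ zero with toℕ (fromℕ n) ℕ.<? n
  ... | yes n<n = ⊥-elim (ℕ.<-irrefl (toℕ-fromℕ n) n<n)
  ... | no _    = refl
  rotate-rotate⁻¹ (suc x) with toℕ (inject₁ x) ℕ.<? n
  ... | yes x<n = cong suc (toℕ-injective (trans (toℕ-fromℕ< x<n) (toℕ-inject₁ x)))
  ... | no x≮n  = ⊥-elim (x≮n (subst (_< n) (≡.sym (toℕ-inject₁ x)) (toℕ<n x)))

  rotation : Fin (suc n) ↔ Fin (suc n)
  rotation = mk↔ₛ′ rotate rotate⁻¹ rotate-rotate⁻¹ rotate⁻¹-rotate

  Step : ℕ → ℕ → Set
  Step a b = b ≡ suc a ⊎ (a ≡ n × b ≡ 0)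

  toℕ-rotate : ∀ x → Step (toℕ x) (toℕ (rotate x))
  toℕ-rotate x with toℕ x ℕ.<? n
  ... | yes x<n = inj₁ (cong suc (toℕ-fromℕ< x<n))
  ... | no x≮n  = inj₂ (toℕ-last x≮n , refl)

  step-irreflexive : ∀ {a} → ¬ Step a a
  step-irreflexive (inj₂ (refl , ()))

  step-acyclic₂ : ∀ {a b} → Step a b → ¬ Step b a
  step-acyclic₂ (inj₁ refl)          (inj₂ (() , refl))
  step-acyclic₂ (inj₂ (refl , refl)) (inj₂ (() , _))

  rotate-no-fixed-point : ∀ x → rotate x ≢ x
  rotate-no-fixed-point x eq = step-irreflexive (subst (Step (toℕ x) ∘ toℕ) eq (toℕ-rotate x))

  rotate-no-2-cycle : ∀ x → rotate (rotate x) ≢ x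
  rotate-no-2-cycle x eq =
    step-acyclic₂ (toℕ-rotate x) (subst (Step (toℕ (rotate x)) ∘ toℕ) eq (toℕ-rotate (rotate x)))

theorem19 : ∀ (s : ℕ) → s ≥ 3 →
    Σ (Graph (2 * s)) λ Γ → Cubic Γ × Bipartite Γ ×
    Σ (Configuration (3 * s)) λ X → StrongChromaticNumber X 3 ×
    Σ (Fin (3 * s) → Fin 3) λ c → StrongColouring X 3 c ×
      (∀ (k : Fin 3) → InducedOffClassIso X c k Γ)
theorem19 (suc (suc (suc m))) (s≤s (s≤s (s≤s _))) =
  graph , cubic neighbours , bipartite side edge-bichromatic ,
  X , ((colouring , strong) , strong-colouring-needs-3 X zero) ,
  colouring , strong ,
  λ k → inducedOffClassIso points configuration proj₁ k (recolouring k) (edge⇔assocAdj k)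
  where
  open Rotation m
  open Construction Fin._≟_ rotation rotate-no-fixed-point rotate-no-2-cycle
  open GraphTransport (*↔× {2} {3 + m}) edge? edge-irrelevant edge-irreflexive edge-sym

  points : Fin (3 * (3 + m)) ↔ Point
  points = *↔×

  X : Configuration (3 * (3 + m))
  X = Transport.configuration points configuration

  colouring : Fin (3 * (3 + m)) → Fin 3
  colouring = proj₁ ∘ Inverse.to points

  strong : StrongColouring X 3 colouring
  strong = Transport.strongColouring points configuration proj₁ (λ _ eq → eq)
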